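{- Let $e_0$ be an expression. For finite $X$, $(\mathrm{cKA},\{e_0\leq 0\})$ reduces to $(\mathrm{cKA},\emptyset)$.
   Context: Take $\Sigma=\{\cdot,1\}$ and $E$ the commutative monoid equations; atoms are finite multisets over $X$ and languages are sets of multisets. Expressions are restricted to the fragment where all fixpoints have the shape $e^*=\mu x.1+e\cdot x$, and cKA is the commutative Kleene algebra axiomatisation, sound and complete for the empty set of hypotheses. $[\![e]\!]_E$ is the standard language interpretation. For a set $H$ of hypotheses, $H^*(L)$ is the least language containing $L$ closed under: if $C[\![f]\!]_E\subseteq L$ for a context $C$ (here a multiset, acting by multiset union) and $(e\leq f)\in H$ then $C[\![e]\!]_E\subseteq L$. The representation $(Q,H)$ interprets $e$ as $H^*[\![e]\!]_E$ with equivalence $e\equiv f$ iff $Q,H\vdash e\leq f$ and $Q,H\vdash f\leq e$. $(Q,H)$ reduces to $(Q',H')$ if there are maps $r,i$ on expressions and $\iota$ from $H$-closed to $H'$-closed languages with: $e'\equiv' f'\Rightarrow i(e')\equiv i(f')$; $i(r(e))\equiv e$; $\iota(H^*[\![e]\!]_E)=H'^*[\![r(e)]\!]_E$. -}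

module Defs where

open import Data.Nat using (ℕ; zero; suc; _+_)
open import Data.Fin using (Fin)
open import Data.Vec using (Vec; zipWith; replicate; tabulate)
open import Data.Product using (Σ; ∃; _×_; _,_)
open import Data.Empty using (⊥)
open import Relation.Binary.PropositionalEquality using (_≡_)
open import Relation.Nullary using (Dec; yes; no)
open import Data.Fin using (_≟_)

-- Expressions of the *-fragment over the finite alphabet X = Fin n
-- (e* stands for μx. 1 + e·x).

infixl 6 _⊕_
infixl 7 _⊗_
infix 8 _⋆

data Expr (n : ℕ) : Set where
  𝟘   : Expr n
  𝟙   : Expr n
  var : Fin n → Expr n
  _⊕_ : Expr n → Expr n → Expr n
  _⊗_ : Expr n → Expr n → Expr n
  _⋆  : Expr n → Expr n

-- Finite multisets over Fin n (atoms of the free commutative monoid),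
-- represented by their multiplicity vectors; multiset union is
-- pointwise addition.

MSet : ℕ → Set
MSet n = Vec ℕ n

∅ₘ : ∀ {n} → MSet n
∅ₘ = replicate _ 0

single : ∀ {n} → Fin n → MSet n
single a = tabulate (λ b → δ a b)
  where
  δ : ∀ {n} → Fin n → Fin n → ℕ
  δ a b with a ≟ b
  ... | yes _ = 1
  ... | no _  = 0

infixl 6 _∪ₘ_
_∪ₘ_ : ∀ {n} → MSet n → MSet n → MSet n
_∪ₘ_ = zipWith _+_

Lang : ℕ → Set₁
Lang n = MSet n → Set

_⊆_ : ∀ {n} → Lang n → Lang n → Set
L ⊆ K = ∀ w → L w → K w

_≐_ : ∀ {n} → Lang n → Lang n → Set
L ≐ K = L ⊆ K × K ⊆ L

data Star {n} (L : Lang n) : Lang n where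
  ε    : Star L ∅ₘ
  step : ∀ {u v} → L u → Star L v → Star L (u ∪ₘ v)

⟦_⟧ : ∀ {n} → Expr n → Lang n
⟦ 𝟘 ⟧ w = ⊥
⟦ 𝟙 ⟧ w = w ≡ ∅ₘ
⟦ var a ⟧ w = w ≡ single a
⟦ e ⊕ f ⟧ w = ⟦ e ⟧ w Data.Sum.⊎ ⟦ f ⟧ w
  where import Data.Sum
⟦ e ⊗ f ⟧ w = Σ _ λ u → Σ _ λ v → ⟦ e ⟧ u × ⟦ f ⟧ v × w ≡ u ∪ₘ v
⟦ e ⋆ ⟧ w = Star ⟦ e ⟧ w

-- Sets of hypotheses: a hypothesis (e ≤ f) ∈ H is a proof of H e f.

Hyps : ℕ → Set₁
Hyps n = Expr n → Expr n → Set

noHyps : ∀ {n} → Hyps n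
noHyps _ _ = ⊥

single-hyp : ∀ {n} → Expr n → Expr n → Hyps n
single-hyp e₀ f₀ e f = (e ≡ e₀) × (f ≡ f₀)

infix 4 _⊢_≈_ _⊢_≤_ _⊢_≡_

data _⊢_≈_ {n} (H : Hyps n) : Expr n → Expr n → Set

_⊢_≤_ : ∀ {n} → Hyps n → Expr n → Expr n → Set
H ⊢ e ≤ f = H ⊢ e ⊕ f ≈ f

data _⊢_≈_ {n} H where
  refl  : ∀ {e} → H ⊢ e ≈ e
  sym   : ∀ {e f} → H ⊢ e ≈ f → H ⊢ f ≈ e
  trans : ∀ {e f g} → H ⊢ e ≈ f → H ⊢ f ≈ g → H ⊢ e ≈ g
  ⊕-cong : ∀ {e e' f f'} → H ⊢ e ≈ e' → H ⊢ f ≈ f' → H ⊢ e ⊕ f ≈ e' ⊕ f'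
  ⊗-cong : ∀ {e e' f f'} → H ⊢ e ≈ e' → H ⊢ f ≈ f' → H ⊢ e ⊗ f ≈ e' ⊗ f'
  ⋆-cong : ∀ {e e'} → H ⊢ e ≈ e' → H ⊢ e ⋆ ≈ e' ⋆
  ⊕-assoc : ∀ {e f g} → H ⊢ (e ⊕ f) ⊕ g ≈ e ⊕ (f ⊕ g)
  ⊕-comm  : ∀ {e f} → H ⊢ e ⊕ f ≈ f ⊕ e
  ⊕-idem  : ∀ {e} → H ⊢ e ⊕ e ≈ e
  ⊕-zero  : ∀ {e} → H ⊢ 𝟘 ⊕ e ≈ e
  ⊗-assoc : ∀ {e f g} → H ⊢ (e ⊗ f) ⊗ g ≈ e ⊗ (f ⊗ g)
  ⊗-comm  : ∀ {e f} → H ⊢ e ⊗ f ≈ f ⊗ e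
  ⊗-unit  : ∀ {e} → H ⊢ 𝟙 ⊗ e ≈ e
  ⊗-zero  : ∀ {e} → H ⊢ 𝟘 ⊗ e ≈ 𝟘
  distrib : ∀ {e f g} → H ⊢ e ⊗ (f ⊕ g) ≈ (e ⊗ f) ⊕ (e ⊗ g)
  ⋆-unfoldˡ : ∀ {e} → H ⊢ 𝟙 ⊕ e ⊗ e ⋆ ≤ e ⋆
  ⋆-unfoldʳ : ∀ {e} → H ⊢ 𝟙 ⊕ e ⋆ ⊗ e ≤ e ⋆
  ⋆-indˡ : ∀ {e f g} → H ⊢ f ⊕ e ⊗ g ≤ g → H ⊢ e ⋆ ⊗ f ≤ g
  ⋆-indʳ : ∀ {e f g} → H ⊢ f ⊕ g ⊗ e ≤ g → H ⊢ f ⊗ e ⋆ ≤ g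
  hyp : ∀ {e f} → H e f → H ⊢ e ≤ f

_⊢_≡_ : ∀ {n} → Hyps n → Expr n → Expr n → Set
H ⊢ e ≡ f = (H ⊢ e ≤ f) × (H ⊢ f ≤ e)

-- Closure H*(L): least language containing L and closed under
--   C·⟦f⟧ ⊆ L , (e ≤ f) ∈ H  ⟹  C·⟦e⟧ ⊆ L
-- (contexts C are multisets acting by multiset union).

data Closure {n} (H : Hyps n) (L : Lang n) : Lang n where
  base : ∀ {w} → L w → Closure H L w
  rule : ∀ {e f} → H e f → (C : MSet n) →
         (∀ u' → ⟦ f ⟧ u' → Closure H L (C ∪ₘ u')) →
         ∀ {u} → ⟦ e ⟧ u → Closure H L (C ∪ₘ u)

IsClosed : ∀ {n} → Hyps n → Lang n → Set
IsClosed H L = Closure H L ⊆ L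

closure-closed : ∀ {n} (H : Hyps n) (L : Lang n) → IsClosed H (Closure H L)
closure-closed H L w (base x) = x
closure-closed H L _ (rule h C prem eu) =
  rule h C (λ u' fu' → closure-closed H L _ (prem u' fu')) eu

record Reduces {n} (H H' : Hyps n) : Set₁ where
  field
    r : Expr n → Expr n
    i : Expr n → Expr n
    -- ι maps H-closed languages to H'-closed languages (as a function on
    -- sets: it respects extensional equality of languages)
    ι        : (L : Lang n) → IsClosed H L → Lang n
    ι-closed : ∀ L (c : IsClosed H L) → IsClosed H' (ι L c)
    ι-ext    : ∀ L (c : IsClosed H L) K (d : IsClosed H K) →
               L ≐ K → ι L c ≐ ι K d
    i-equiv : ∀ e f → H' ⊢ e ≡ f → H ⊢ i e ≡ i f
    i∘r     : ∀ e → H ⊢ i (r e) ≡ e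
    ι-sem   : ∀ e → ι (Closure H ⟦ e ⟧) (closure-closed H ⟦ e ⟧)
                      ≐ Closure H' ⟦ r e ⟧

-- Under the hypothesis e₀ ≤ 0 the axioms prove e₀ ≡ 0, so i = id works on the
-- syntactic side.  Semantically the premise of the closure rule is vacuous
-- (⟦0⟧ is empty), so H* adds every multiset C ∪ u with u ∈ ⟦e₀⟧: the
-- closure of ⟦e⟧ is ⟦e + X*·e₀⟧, where X is the (finite!) sum of all letters
-- and ⟦X*⟧ is the full language.  Hence r e = e + X*·e₀ and ι = id.
module Submission where

open import Defs
open import Data.Nat using (ℕ; zero; suc)
open import Data.Nat.Properties using (+-identityˡ)
open import Data.Fin using (Fin; zero; suc; _≟_)
open import Data.List using (List; []; _∷_; allFin)
open import Data.List.Membership.Propositional using (_∈_)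
open import Data.List.Membership.Propositional.Properties using (∈-allFin)
open import Data.List.Relation.Unary.Any using (here; there)
open import Data.Vec using ([]; _∷_; lookup; tabulate)
open import Data.Vec.Properties
  using (lookup∘tabulate; tabulate∘lookup; tabulate-cong; lookup-replicate; zipWith-identityˡ)
open import Data.Product using (∃; _,_)
open import Data.Sum using (_⊎_; inj₁; inj₂)
open import Function using (id; _∋_)
open import Relation.Nullary using (yes; no)
open import Relation.Binary.PropositionalEquality
  using (_≡_; refl; cong; subst; module ≡-Reasoning)
  renaming (sym to ≡-sym; trans to ≡-trans)

private
  variable
    n : ℕ
    H H' : Hyps n
    e f : Expr n

⊢-mono : (∀ {e f} → H e f → H' e f) → H ⊢ e ≈ f → H' ⊢ e ≈ f
⊢-mono H⊆H' refl          = refl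
⊢-mono H⊆H' (sym p)       = sym (⊢-mono H⊆H' p)
⊢-mono H⊆H' (trans p q)   = trans (⊢-mono H⊆H' p) (⊢-mono H⊆H' q)
⊢-mono H⊆H' (⊕-cong p q)  = ⊕-cong (⊢-mono H⊆H' p) (⊢-mono H⊆H' q)
⊢-mono H⊆H' (⊗-cong p q)  = ⊗-cong (⊢-mono H⊆H' p) (⊢-mono H⊆H' q)
⊢-mono H⊆H' (⋆-cong p)    = ⋆-cong (⊢-mono H⊆H' p)
⊢-mono H⊆H' ⊕-assoc       = ⊕-assoc
⊢-mono H⊆H' ⊕-comm        = ⊕-comm
⊢-mono H⊆H' ⊕-idem        = ⊕-idem
⊢-mono H⊆H' ⊕-zero        = ⊕-zero
⊢-mono H⊆H' ⊗-assoc       = ⊗-assoc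
⊢-mono H⊆H' ⊗-comm        = ⊗-comm
⊢-mono H⊆H' ⊗-unit        = ⊗-unit
⊢-mono H⊆H' ⊗-zero        = ⊗-zero
⊢-mono H⊆H' distrib       = distrib
⊢-mono H⊆H' ⋆-unfoldˡ     = ⋆-unfoldˡ
⊢-mono H⊆H' ⋆-unfoldʳ     = ⋆-unfoldʳ
⊢-mono H⊆H' (⋆-indˡ p)    = ⋆-indˡ (⊢-mono H⊆H' p)
⊢-mono H⊆H' (⋆-indʳ p)    = ⋆-indʳ (⊢-mono H⊆H' p)
⊢-mono H⊆H' (hyp h)       = hyp (H⊆H' h)

≈⇒≡ : H ⊢ e ≈ f → H ⊢ e ≡ f
≈⇒≡ e≈f = trans (⊕-cong e≈f refl) ⊕-idem , trans (⊕-cong (sym e≈f) refl) ⊕-idem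

≤𝟘⇒≈𝟘 : H ⊢ e ≤ 𝟘 → H ⊢ e ≈ 𝟘
≤𝟘⇒≈𝟘 e≤𝟘 = trans (sym ⊕-zero) (trans ⊕-comm e≤𝟘)

⊗-zeroʳ-≈ : H ⊢ f ≈ 𝟘 → H ⊢ e ⊗ f ≈ 𝟘
⊗-zeroʳ-≈ f≈𝟘 = trans (⊗-cong refl f≈𝟘) (trans ⊗-comm ⊗-zero)

⊕-identityʳ-≈ : H ⊢ f ≈ 𝟘 → H ⊢ e ⊕ f ≈ e
⊕-identityʳ-≈ f≈𝟘 = trans (⊕-cong refl f≈𝟘) (trans ⊕-comm ⊕-zero)

lookup-single-suc : (a b : Fin n) → lookup (single (suc a)) (suc b) ≡ lookup (single a) b
-- Both entries compute to the same case split on a ≟ b (that of suc a ≟ suc b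
-- is a map over it), which only becomes visible after abstracting it.
lookup-single-suc a b
  with a ≟ b
     | (lookup (single (suc a)) (suc b) ≡ _ ∋ lookup∘tabulate _ b)
     | (lookup (single a) b ≡ _ ∋ lookup∘tabulate _ b)
... | yes _ | lhs | rhs = ≡-trans lhs (≡-sym rhs)
... | no _  | lhs | rhs = ≡-trans lhs (≡-sym rhs)

lookup-injective : {u v : MSet n} → (∀ i → lookup u i ≡ lookup v i) → u ≡ v
lookup-injective {u = u} {v} u≗v = begin
  u                   ≡⟨ ≡-sym (tabulate∘lookup u) ⟩
  tabulate (lookup u) ≡⟨ tabulate-cong u≗v ⟩
  tabulate (lookup v) ≡⟨ tabulate∘lookup v ⟩
  v                   ∎
  where open ≡-Reasoning

single-zero : single {suc n} zero ≡ 1 ∷ ∅ₘ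
single-zero = lookup-injective λ where
  zero    → refl
  (suc b) → ≡-trans (lookup∘tabulate _ b) (≡-sym (lookup-replicate b 0))

single-suc : (a : Fin n) → single (suc a) ≡ 0 ∷ single a
single-suc a = lookup-injective λ where
  zero    → refl
  (suc b) → lookup-single-suc a b

∅ₘ-∪ₘ : (w : MSet n) → ∅ₘ ∪ₘ w ≡ w
∅ₘ-∪ₘ = zipWith-identityˡ +-identityˡ

Singleton : Lang n
Singleton w = ∃ λ a → w ≡ single a

Star-map : ∀ {m} {L : Lang n} {K : Lang m} (h : MSet n → MSet m) →
           h ∅ₘ ≡ ∅ₘ → (∀ u v → h (u ∪ₘ v) ≡ h u ∪ₘ h v) →
           (∀ {w} → L w → K (h w)) → ∀ {w} → Star L w → Star K (h w)
Star-map {K = K} h h-∅ₘ h-∪ₘ L⇒K ε = subst (Star K) (≡-sym h-∅ₘ) ε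
Star-map {K = K} h h-∅ₘ h-∪ₘ L⇒K (step {u} {v} x s) =
  subst (Star K) (≡-sym (h-∪ₘ u v)) (step (L⇒K x) (Star-map h h-∅ₘ h-∪ₘ L⇒K s))

Star-Singleton : (w : MSet n) → Star Singleton w
Star-Singleton []          = ε
Star-Singleton (zero ∷ w)  =
  Star-map (0 ∷_) refl (λ _ _ → refl) shift (Star-Singleton w)
  where
  shift : ∀ {w} → Singleton w → Singleton (0 ∷ w)
  shift (a , refl) = suc a , ≡-sym (single-suc a)
Star-Singleton (suc k ∷ w) =
  subst (Star Singleton) (cong (suc k ∷_) (∅ₘ-∪ₘ w))
        (step (zero , ≡-sym single-zero) (Star-Singleton (k ∷ w)))

sumVars : List (Fin n) → Expr n
sumVars []       = 𝟘
sumVars (a ∷ as) = var a ⊕ sumVars as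

∈⇒⟦sumVars⟧ : ∀ {a} {as : List (Fin n)} → a ∈ as → ⟦ sumVars as ⟧ (single a)
∈⇒⟦sumVars⟧ (here refl) = inj₁ refl
∈⇒⟦sumVars⟧ (there a∈as) = inj₂ (∈⇒⟦sumVars⟧ a∈as)

letters : Expr n
letters {n} = sumVars (allFin n)

⟦letters⋆⟧-universal : (w : MSet n) → ⟦ letters ⋆ ⟧ w
⟦letters⋆⟧-universal w =
  Star-map id refl (λ _ _ → refl) (λ { (a , refl) → ∈⇒⟦sumVars⟧ (∈-allFin a) })
           (Star-Singleton w)

noHyps-closed : (L : Lang n) → IsClosed noHyps L
noHyps-closed L _ (base x) = x

Closure-≤𝟘 : ∀ (e₀ : Expr n) L →
             Closure (single-hyp e₀ 𝟘) L ≐ λ w → L w ⊎ ⟦ letters ⋆ ⊗ e₀ ⟧ w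
Closure-≤𝟘 e₀ L = to , from
  where
  to : Closure (single-hyp e₀ 𝟘) L ⊆ (λ w → L w ⊎ ⟦ letters ⋆ ⊗ e₀ ⟧ w)
  to _ (base x) = inj₁ x
  to _ (rule (refl , refl) C _ {u} e₀u) = inj₂ (C , u , ⟦letters⋆⟧-universal C , e₀u , refl)
  from : (λ w → L w ⊎ ⟦ letters ⋆ ⊗ e₀ ⟧ w) ⊆ Closure (single-hyp e₀ 𝟘) L
  from _ (inj₁ x) = base x
  from _ (inj₂ (C , u , _ , e₀u , refl)) = rule (refl , refl) C (λ _ ()) e₀u

lemma7p4 : ∀ {n} (e₀ : Expr n) → Reduces (single-hyp e₀ 𝟘) noHyps
lemma7p4 e₀ = record
  { r        = r
  ; i        = id
  ; ι        = λ L _ → L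
  ; ι-closed = λ L _ → noHyps-closed L
  ; ι-ext    = λ _ _ _ _ L≐K → L≐K
  ; i-equiv  = λ _ _ (e≤f , f≤e) → ⊢-mono (λ ()) e≤f , ⊢-mono (λ ()) f≤e
  ; i∘r      = λ _ → ≈⇒≡ (⊕-identityʳ-≈ (⊗-zeroʳ-≈ e₀≈𝟘))
  ; ι-sem    = λ e → let H*⟦e⟧⊆⟦re⟧ , ⟦re⟧⊆H*⟦e⟧ = Closure-≤𝟘 e₀ ⟦ e ⟧ in
                     (λ w x → base (H*⟦e⟧⊆⟦re⟧ w x)) ,
                     (λ w x → ⟦re⟧⊆H*⟦e⟧ w (noHyps-closed _ w x))
  }
  where
  r : Expr _ → Expr _
  r e = e ⊕ letters ⋆ ⊗ e₀
  e₀≈𝟘 : single-hyp e₀ 𝟘 ⊢ e₀ ≈ 𝟘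
  e₀≈𝟘 = ≤𝟘⇒≈𝟘 (hyp (refl , refl))
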